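{- Let $M$ be a grid graph and $s,t$ nodes of $M$. Every non-separating induced $st$-path in $M$ has at most one boundary subpath.
   Context: An $m\times n$ grid graph has node set $\{M_{ij}\}$, $1\leq i\leq m$, $1\leq j\leq n$, with edges between nodes consecutive in a row or a column. Its boundary is the set of nodes in the first or last row or first or last column. A path $P$ is induced if the subgraph induced by $V(P)$ is $P$; it is non-separating if $M-V(P)$ is connected. A boundary subpath of $P$ is a maximal subpath of $P$ all of whose nodes lie on the boundary (it may consist of a single node). -}

module Defs where

open import Data.Nat using (ℕ; zero; suc; _≤_)
open import Data.Fin using (Fin; toℕ)
open import Data.Product using (_×_; _,_; ∃; Σ)
open import Data.Sum using (_⊎_)
open import Relation.Binary.PropositionalEquality using (_≡_)
open import Relation.Nullary using (¬_)
open import Function.Definitions using (Injective)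

-- Nodes of the m × n grid graph: M (i , j), row i, column j (0-indexed).
Node : ℕ → ℕ → Set
Node m n = Fin m × Fin n

Consec : ∀ {k} → Fin k → Fin k → Set
Consec a b = toℕ b ≡ suc (toℕ a) ⊎ toℕ a ≡ suc (toℕ b)

Adj : ∀ {m n} → Node m n → Node m n → Set
Adj (i , j) (i' , j') = (i ≡ i' × Consec j j') ⊎ (j ≡ j' × Consec i i')

Boundary : ∀ {m n} → Node m n → Set
Boundary {m} {n} (i , j) =
  toℕ i ≡ 0 ⊎ suc (toℕ i) ≡ m ⊎ toℕ j ≡ 0 ⊎ suc (toℕ j) ≡ n

-- A path with k+1 nodes, given as the sequence p 0, …, p k of its nodes.
Seq : ℕ → ℕ → ℕ → Set
Seq m n k = Fin (suc k) → Node m n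

IsPath : ∀ {m n k} → Seq m n k → Set
IsPath {k = k} p =
  Injective _≡_ _≡_ p × (∀ (a b : Fin (suc k)) → Consec a b → Adj (p a) (p b))

IsSTPath : ∀ {m n k} → Node m n → Node m n → Seq m n k → Set
IsSTPath {k = k} s t p =
  IsPath p × p Data.Fin.zero ≡ s × p (Data.Fin.fromℕ k) ≡ t

IsInduced : ∀ {m n k} → Seq m n k → Set
IsInduced {k = k} p = ∀ (a b : Fin (suc k)) → Adj (p a) (p b) → Consec a b

OnPath : ∀ {m n k} → Seq m n k → Node m n → Set
OnPath {k = k} p u = ∃ λ (a : Fin (suc k)) → p a ≡ u

data Walk {m n : ℕ} (Allowed : Node m n → Set) : Node m n → Node m n → Set where
  stop : ∀ {u} → Allowed u → Walk Allowed u u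
  step : ∀ {u w v} → Allowed u → Adj u w → Walk Allowed w v → Walk Allowed u v

NonSeparating : ∀ {m n k} → Seq m n k → Set
NonSeparating {m} {n} p =
  ∀ (u v : Node m n) → ¬ OnPath p u → ¬ OnPath p v →
    Walk (λ x → ¬ OnPath p x) u v

-- The subpath p a, …, p b (a ≤ b) is a boundary subpath of p:
-- all its nodes lie on the boundary, and it is maximal with this property.
IsBoundarySubpath : ∀ {m n k} → Seq m n k → Fin (suc k) → Fin (suc k) → Set
IsBoundarySubpath {k = k} p a b =
  toℕ a ≤ toℕ b
  × (∀ (l : Fin (suc k)) → toℕ a ≤ toℕ l → toℕ l ≤ toℕ b → Boundary (p l))
  × (toℕ a ≡ 0 ⊎ (∃ λ (l : Fin (suc k)) → suc (toℕ l) ≡ toℕ a × ¬ Boundary (p l)))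
  × (toℕ b ≡ k ⊎ (∃ λ (l : Fin (suc k)) → toℕ l ≡ suc (toℕ b) × ¬ Boundary (p l)))

module Submission where

-- Two different boundary subpaths force an excursion: an index b with P b on the boundary,
-- P (b+1) in the interior, and P back on the boundary at a later index b+L.  Excursions are
-- impossible by a discrete Jordan-curve argument.  Up to a grid symmetry the excursion
-- starts at P b = (0, j+1) in the top row and steps down to (1, j+1).  Closed up outside
-- the grid, Q = P b, …, P (b+L) gets a winding parity (parity of crossings of a horizontal
-- ray; module Winding) that is constant along grid edges avoiding Q but differs at the two
-- row neighbours (0, j), (0, j+2) of P b.  These neighbours, or the nodes below them when
-- they lie on P, are off P, so the walk between them that non-separation provides is
-- impossible.

open import Defs
open import Data.Nat using (ℕ; zero; suc; _+_; _∸_; _≤_; _<_; z≤n; s≤s; _≡ᵇ_; _<ᵇ_; _≤?_)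
open import Data.Nat.Properties
open import Data.Bool using (Bool; true; false; _∧_; _∨_; _xor_; not; if_then_else_; T)
open import Data.Bool.Properties
  using (xor-assoc; xor-comm; xor-same; xor-identityʳ; ∨-comm; ∧-zeroʳ; not-¬; ¬-not; xor-∧-commutativeRing)
open import Data.Fin using (Fin; toℕ; fromℕ<; opposite)
import Data.Fin as Fin
open import Data.Fin.Properties using (toℕ-injective; toℕ<n; toℕ-fromℕ<; any?; opposite-prop; opposite-involutive)
open import Data.Product using (_×_; _,_; proj₁; proj₂; ∃; Σ)
open import Data.Sum using (_⊎_; inj₁; inj₂; [_,_]′)
open import Data.Empty using (⊥; ⊥-elim)
open import Function using (case_of_)
open import Data.Unit using (tt)
open import Relation.Binary.PropositionalEquality
open import Relation.Nullary using (¬_; yes; no; Dec)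
open import Algebra.Bundles using (CommutativeRing)
open import Algebra.Properties.CommutativeSemigroup
  (CommutativeRing.+-commutativeSemigroup xor-∧-commutativeRing)
  using () renaming (interchange to xor-interchange)

xor-telescope : ∀ a b c → (a xor b) xor (b xor c) ≡ a xor c
xor-telescope a b c =
  trans (cong (_xor (b xor c)) (xor-comm a b))
        (trans (xor-interchange b a b c) (cong (_xor (a xor c)) (xor-same b)))

xor-cancelʳ : ∀ s t → (s xor t) xor s ≡ t
xor-cancelʳ s t =
  trans (xor-comm (s xor t) s) (trans (sym (xor-assoc s s t)) (cong (_xor t) (xor-same s)))

xor≡false⇒≡ : ∀ a b → a xor b ≡ false → a ≡ b
xor≡false⇒≡ true true _ = refl
xor≡false⇒≡ false false _ = refl

∧-true : ∀ a b → a ∧ b ≡ true → a ≡ true × b ≡ true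
∧-true true true refl = refl , refl

∨-true : ∀ a b → a ∨ b ≡ true → a ≡ true ⊎ b ≡ true
∨-true true b _ = inj₁ refl
∨-true false b e = inj₂ e

≡ᵇ-true : ∀ m n → (m ≡ᵇ n) ≡ true → m ≡ n
≡ᵇ-true m n e = ≡ᵇ⇒≡ m n (subst T (sym e) tt)

≡ᵇ-refl : ∀ m → (m ≡ᵇ m) ≡ true
≡ᵇ-refl zero = refl
≡ᵇ-refl (suc m) = ≡ᵇ-refl m

≡ᵇ-false : ∀ m n → ¬ m ≡ n → (m ≡ᵇ n) ≡ false
≡ᵇ-false m n m≢n with m ≡ᵇ n in e
... | true = ⊥-elim (m≢n (≡ᵇ-true m n e))
... | false = refl

≡ᵇ-sym : ∀ m n → (m ≡ᵇ n) ≡ (n ≡ᵇ m)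
≡ᵇ-sym zero zero = refl
≡ᵇ-sym zero (suc n) = refl
≡ᵇ-sym (suc m) zero = refl
≡ᵇ-sym (suc m) (suc n) = ≡ᵇ-sym m n

≡ᵇ-suc : ∀ c → (c ≡ᵇ suc c) ≡ false
≡ᵇ-suc zero = refl
≡ᵇ-suc (suc c) = ≡ᵇ-suc c

≡ᵇ-suc-suc : ∀ r → (r ≡ᵇ suc (suc r)) ≡ false
≡ᵇ-suc-suc zero = refl
≡ᵇ-suc-suc (suc r) = ≡ᵇ-suc-suc r

<⇒<ᵇ-true : ∀ m n → m < n → (m <ᵇ n) ≡ true
<⇒<ᵇ-true zero (suc n) _ = refl
<⇒<ᵇ-true (suc m) (suc n) (s≤s m<n) = <⇒<ᵇ-true m n m<n

<ᵇ-split : ∀ j c → (j <ᵇ c) ≡ (suc j <ᵇ c) xor (c ≡ᵇ suc j)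
<ᵇ-split j zero = refl
<ᵇ-split zero (suc zero) = refl
<ᵇ-split zero (suc (suc c)) = refl
<ᵇ-split (suc j) (suc c) = <ᵇ-split j c

<ᵇ-suc : ∀ j c → ¬ c ≡ j → (j <ᵇ c) ≡ (j <ᵇ suc c)
<ᵇ-suc j c c≢j =
  sym (trans (<ᵇ-split j (suc c)) (trans (cong ((j <ᵇ c) xor_) (≡ᵇ-false c j c≢j)) (xor-identityʳ _)))

parity : (ℕ → Bool) → ℕ → Bool
parity f zero = false
parity f (suc L) = parity f L xor f L

parity-cong : ∀ f h L → (∀ l → l < L → f l ≡ h l) → parity f L ≡ parity h L
parity-cong f h zero e = refl
parity-cong f h (suc L) e =
  cong₂ _xor_ (parity-cong f h L (λ l l<L → e l (m<n⇒m<1+n l<L))) (e L ≤-refl)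

parity-xor : ∀ f h L → parity (λ l → f l xor h l) L ≡ parity f L xor parity h L
parity-xor f h zero = refl
parity-xor f h (suc L) =
  trans (cong (_xor (f L xor h L)) (parity-xor f h L))
        (xor-interchange (parity f L) (parity h L) (f L) (h L))

parity-telescope : ∀ (h : ℕ → Bool) L → parity (λ l → h l xor h (suc l)) L ≡ h 0 xor h L
parity-telescope h zero = sym (xor-same (h 0))
parity-telescope h (suc L) rewrite parity-telescope h L = xor-telescope (h 0) (h L) (h (suc L))

parity-false : ∀ f L → (∀ l → l < L → f l ≡ false) → parity f L ≡ false
parity-false f zero e = refl
parity-false f (suc L) e
  rewrite parity-false f L (λ l l<L → e l (m<n⇒m<1+n l<L)) | e L ≤-refl = refl

parity-only-first : ∀ f L → 1 ≤ L → f 0 ≡ true → (∀ l → 1 ≤ l → l < L → f l ≡ false) →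
                    parity f L ≡ true
parity-only-first f (suc zero) _ f0 _ = f0
parity-only-first f (suc (suc L)) _ f0 rest
  rewrite parity-only-first f (suc L) (s≤s z≤n) f0 (λ l 1≤l l<L → rest l 1≤l (m<n⇒m<1+n l<L))
        | rest (suc L) (s≤s z≤n) ≤-refl = refl

Adjℕ : ℕ → ℕ → ℕ → ℕ → Set
Adjℕ r c r' c' = (r ≡ r' × (c' ≡ suc c ⊎ c ≡ suc c')) ⊎ (c ≡ c' × (r' ≡ suc r ⊎ r ≡ suc r'))

Boundaryℕ : ℕ → ℕ → ℕ → ℕ → Set
Boundaryℕ m n r c = r ≡ 0 ⊎ suc r ≡ m ⊎ c ≡ 0 ⊎ suc c ≡ n

-- Node (i, j) stands for the unit face with top-left corner (i, j); its ray is the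
-- horizontal half-line from the centre of that face to the right.  It crosses exactly
-- the vertical edges between rows i and i+1 lying in a column > j.

straddles : ℕ → ℕ → ℕ → Bool
straddles i r r' = ((r ≡ᵇ i) ∧ (r' ≡ᵇ suc i)) ∨ ((r' ≡ᵇ i) ∧ (r ≡ᵇ suc i))

crosses : ℕ → ℕ → ℕ → ℕ → ℕ → ℕ → Bool
crosses i j r c r' c' = (c ≡ᵇ c') ∧ (straddles i r r' ∧ (j <ᵇ c))

crossesAt : ℕ → ℕ → ℕ → ℕ → ℕ → ℕ → Bool
crossesAt i j r c r' c' = (c ≡ᵇ c') ∧ (straddles i r r' ∧ (c ≡ᵇ j))

-- The node (r, c) lies on the segment separating the rays of faces (i, j) and (i+1, j).
onSeparator : ℕ → ℕ → ℕ → ℕ → Bool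
onSeparator i j r c = (r ≡ᵇ suc i) ∧ (j <ᵇ c)

straddles-true : ∀ i r r' → straddles i r r' ≡ true → (r ≡ i × r' ≡ suc i) ⊎ (r' ≡ i × r ≡ suc i)
straddles-true i r r' e with ∨-true _ _ e
... | inj₁ x = let (a , b) = ∧-true _ _ x in inj₁ (≡ᵇ-true _ _ a , ≡ᵇ-true _ _ b)
... | inj₂ x = let (a , b) = ∧-true _ _ x in inj₂ (≡ᵇ-true _ _ a , ≡ᵇ-true _ _ b)

straddles-sym : ∀ i r r' → straddles i r r' ≡ straddles i r' r
straddles-sym i r r' = ∨-comm ((r ≡ᵇ i) ∧ (r' ≡ᵇ suc i)) ((r' ≡ᵇ i) ∧ (r ≡ᵇ suc i))

straddles-down : ∀ i r → straddles i r (suc r) ≡ (r ≡ᵇ i)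
straddles-down i r with r ≟ i
... | yes refl rewrite ≡ᵇ-refl r = refl
... | no r≢i rewrite ≡ᵇ-false r i r≢i with suc r ≟ i
...   | yes refl rewrite ≡ᵇ-suc-suc r | ≡ᵇ-refl r = refl
...   | no r+1≢i rewrite ≡ᵇ-false (suc r) i r+1≢i = refl

crosses-sym : ∀ i j r c r' c' → crosses i j r c r' c' ≡ crosses i j r' c' r c
crosses-sym i j r c r' c' with c ≟ c'
... | yes refl rewrite straddles-sym i r r' = refl
... | no c≢c' rewrite ≡ᵇ-false c c' c≢c' | ≡ᵇ-false c' c (λ e → c≢c' (sym e)) = refl

-- Moving a face one column right, its ray loses the edges in column j+1.
crosses-shift : ∀ i j r c r' c' →
  crosses i j r c r' c' ≡ crosses i (suc j) r c r' c' xor crossesAt i (suc j) r c r' c'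
crosses-shift i j r c r' c' with c ≡ᵇ c'
... | false = refl
... | true with straddles i r r'
...   | false = refl
...   | true = <ᵇ-split j c

-- Moving a face one row down, a grid edge avoiding node (i+1, j) changes the crossing
-- parity exactly when one of its ends lies on the separating segment.
crosses-down-horizontal : ∀ i j r c → ¬ (r ≡ suc i × c ≡ j) →
  crosses i j r c r (suc c) xor crosses (suc i) j r c r (suc c) ≡ onSeparator i j r c xor onSeparator i j r (suc c)
crosses-down-horizontal i j r c avoid rewrite ≡ᵇ-suc c with r ≟ suc i
... | no r≢i+1 rewrite ≡ᵇ-false r (suc i) r≢i+1 = refl
... | yes refl rewrite ≡ᵇ-refl i | <ᵇ-suc j c (λ e → avoid (refl , e)) = sym (xor-same (j <ᵇ suc c))

crosses-down-vertical : ∀ i j r c →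
  crosses i j r c (suc r) c xor crosses (suc i) j r c (suc r) c ≡ onSeparator i j r c xor onSeparator i j (suc r) c
crosses-down-vertical i j r c rewrite ≡ᵇ-refl c | straddles-down i r | straddles-down (suc i) r =
  xor-comm ((r ≡ᵇ i) ∧ (j <ᵇ c)) ((r ≡ᵇ suc i) ∧ (j <ᵇ c))

crosses-down : ∀ i j r c r' c' → Adjℕ r c r' c' → ¬ (r ≡ suc i × c ≡ j) → ¬ (r' ≡ suc i × c' ≡ j) →
  crosses i j r c r' c' xor crosses (suc i) j r c r' c' ≡ onSeparator i j r c xor onSeparator i j r' c'
crosses-down i j r c .r .(suc c) (inj₁ (refl , inj₁ refl)) avoid _ = crosses-down-horizontal i j r c avoid
crosses-down i j r .(suc c') .r c' (inj₁ (refl , inj₂ refl)) _ avoid'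
  rewrite crosses-sym i j r (suc c') r c' | crosses-sym (suc i) j r (suc c') r c' =
  trans (crosses-down-horizontal i j r c' avoid') (xor-comm (onSeparator i j r c') (onSeparator i j r (suc c')))
crosses-down i j r c .(suc r) .c (inj₂ (refl , inj₁ refl)) _ _ = crosses-down-vertical i j r c
crosses-down i j .(suc r') c r' .c (inj₂ (refl , inj₂ refl)) _ _
  rewrite crosses-sym i j (suc r') c r' c | crosses-sym (suc i) j (suc r') c r' c =
  trans (crosses-down-vertical i j r' c) (xor-comm (onSeparator i j r' c) (onSeparator i j (suc r') c))

-- Winding parity of a walk Q = (R 0, C 0), …, (R L, C L) whose two ends lie on the
-- boundary of the m × n grid.  Q is closed up by a path outside the grid from each end to
-- a fixed far point; 'closure' is the parity of crossings of that path with a ray, and the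
-- winding parity of a face is the parity of all crossings of its ray.
module Winding (m n L : ℕ) (R C : ℕ → ℕ) where

  crossing : ℕ → ℕ → ℕ → Bool
  crossing i j l = crosses i j (R l) (C l) (R (suc l)) (C (suc l))

  crossingAt : ℕ → ℕ → ℕ → Bool
  crossingAt i j l = crossesAt i j (R l) (C l) (R (suc l)) (C (suc l))

  rayParity : ℕ → ℕ → Bool
  rayParity i j = parity (crossing i j) L

  columnParity : ℕ → ℕ → Bool
  columnParity i j = parity (crossingAt i j) L

  -- From an end (r, c) in the last column the closing path leaves to the right and meets
  -- the rays of the faces above row r; from the last row it leaves downwards, meeting the
  -- rays of row r left of column c; from the first row or column it meets no ray.
  closure : ℕ → ℕ → ℕ → ℕ → Bool
  closure r c i j =
    if suc c ≡ᵇ n then i <ᵇ r else (if suc r ≡ᵇ m then (i ≡ᵇ r) ∧ (j <ᵇ c) else false)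

  -- The change of 'closure' from face (i, j) to face (i, j+1).
  closureAt : ℕ → ℕ → ℕ → ℕ → Bool
  closureAt r c i j =
    if suc c ≡ᵇ n then false else (if suc r ≡ᵇ m then (i ≡ᵇ r) ∧ (c ≡ᵇ suc j) else false)

  winding : ℕ → ℕ → Bool
  winding i j = rayParity i j xor (closure (R 0) (C 0) i j xor closure (R L) (C L) i j)

  Avoids : ℕ → ℕ → Set
  Avoids i j = ∀ l → l ≤ L → ¬ (R l ≡ i × C l ≡ j)

  crossingAt-end : ∀ i j l → crossingAt i j l ≡ true → (R l ≡ i × C l ≡ j) ⊎ (R (suc l) ≡ i × C (suc l) ≡ j)
  crossingAt-end i j l e with ∧-true (C l ≡ᵇ C (suc l)) _ e
  ... | sameCol , rest with ∧-true (straddles i (R l) (R (suc l))) (C l ≡ᵇ j) rest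
  ...   | rows , colJ with straddles-true i (R l) (R (suc l)) rows
  ...     | inj₁ (r≡i , _) = inj₁ (r≡i , ≡ᵇ-true (C l) j colJ)
  ...     | inj₂ (r'≡i , _) =
    inj₂ (r'≡i , trans (sym (≡ᵇ-true (C l) (C (suc l)) sameCol)) (≡ᵇ-true (C l) j colJ))

  closure-shift : ∀ r c i j → closure r c i j ≡ closure r c i (suc j) xor closureAt r c i j
  closure-shift r c i j with suc c ≡ᵇ n
  ... | true = sym (xor-identityʳ _)
  ... | false with suc r ≡ᵇ m
  ...   | false = refl
  ...   | true with i ≡ᵇ r
  ...     | false = refl
  ...     | true = <ᵇ-split j c

  closureAt-false : ∀ r c i j → ¬ (r ≡ i × c ≡ suc j) → closureAt r c i j ≡ false
  closureAt-false r c i j avoid with suc c ≡ᵇ n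
  ... | true = refl
  ... | false with suc r ≡ᵇ m
  ...   | false = refl
  ...   | true with i ≟ r
  ...     | no i≢r rewrite ≡ᵇ-false i r i≢r = refl
  ...     | yes refl with c ≟ suc j
  ...       | no c≢j+1 rewrite ≡ᵇ-refl i | ≡ᵇ-false c (suc j) c≢j+1 = refl
  ...       | yes refl = ⊥-elim (avoid (refl , refl))

  closureAt-top : ∀ r c j → ¬ m ≡ 1 → closureAt r c 0 j ≡ false
  closureAt-top r c j m≢1 with suc c ≡ᵇ n
  ... | true = refl
  ... | false with suc r ≡ᵇ m in e
  ...   | false = refl
  ...   | true with r
  ...     | suc _ = refl
  ...     | zero = ⊥-elim (m≢1 (sym (≡ᵇ-true _ _ e)))

  winding-shift : ∀ i j → winding i j ≡
    winding i (suc j) xor (columnParity i (suc j) xor (closureAt (R 0) (C 0) i j xor closureAt (R L) (C L) i j))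
  winding-shift i j = begin
      rayParity i j xor (g₀ j xor g₁ j)
    ≡⟨ cong₂ _xor_ rays closures ⟩
      (rayParity i (suc j) xor columnParity i (suc j)) xor ((g₀ (suc j) xor g₁ (suc j)) xor (d₀ xor d₁))
    ≡⟨ xor-interchange (rayParity i (suc j)) (columnParity i (suc j)) (g₀ (suc j) xor g₁ (suc j)) (d₀ xor d₁) ⟩
      winding i (suc j) xor (columnParity i (suc j) xor (d₀ xor d₁))
    ∎
    where
    open ≡-Reasoning
    g₀ g₁ : ℕ → Bool
    g₀ = closure (R 0) (C 0) i
    g₁ = closure (R L) (C L) i
    d₀ d₁ : Bool
    d₀ = closureAt (R 0) (C 0) i j
    d₁ = closureAt (R L) (C L) i j
    rays : rayParity i j ≡ rayParity i (suc j) xor columnParity i (suc j)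
    rays = trans (parity-cong (crossing i j) (λ l → crossing i (suc j) l xor crossingAt i (suc j) l) L
                   (λ l _ → crosses-shift i j (R l) (C l) (R (suc l)) (C (suc l))))
                 (parity-xor (crossing i (suc j)) (crossingAt i (suc j)) L)
    closures : g₀ j xor g₁ j ≡ (g₀ (suc j) xor g₁ (suc j)) xor (d₀ xor d₁)
    closures = trans (cong₂ _xor_ (closure-shift (R 0) (C 0) i j) (closure-shift (R L) (C L) i j))
                     (xor-interchange (g₀ (suc j)) d₀ (g₁ (suc j)) d₁)

  winding-horizontal : ∀ i j → Avoids i (suc j) → winding i j ≡ winding i (suc j)
  winding-horizontal i j avoid =
    trans (winding-shift i j) (trans (cong (winding i (suc j) xor_) noChange) (xor-identityʳ _))
    where
    noColumnCrossing : ∀ l → l < L → crossingAt i (suc j) l ≡ false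
    noColumnCrossing l l<L = ¬-not λ crossed →
      [ avoid l (<⇒≤ l<L) , avoid (suc l) l<L ]′ (crossingAt-end i (suc j) l crossed)
    noChange : columnParity i (suc j) xor (closureAt (R 0) (C 0) i j xor closureAt (R L) (C L) i j) ≡ false
    noChange rewrite parity-false (crossingAt i (suc j)) L noColumnCrossing
                   | closureAt-false (R 0) (C 0) i j (avoid 0 z≤n)
                   | closureAt-false (R L) (C L) i j (avoid L ≤-refl) = refl

  closure-down : ∀ r c i j → Boundaryℕ m n r c → suc (suc i) ≤ m → j < n → ¬ (r ≡ suc i × c ≡ j) →
                 closure r c i j xor closure r c (suc i) j ≡ onSeparator i j r c
  closure-down r c i j bd i+2≤m j<n avoid with suc c ≡ᵇ n in lastCol
  ... | true rewrite <ᵇ-split i r with r ≟ suc i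
  ...   | no r≢i+1 rewrite ≡ᵇ-false _ _ r≢i+1 = xor-cancelʳ (suc i <ᵇ r) false
  ...   | yes refl rewrite ≡ᵇ-refl i = trans (xor-cancelʳ (i <ᵇ i) true) (sym (<⇒<ᵇ-true j c j<c))
    where
    c+1≡n : suc c ≡ n
    c+1≡n = ≡ᵇ-true _ _ lastCol
    j<c : j < c
    j<c = ≤∧≢⇒< (≤-pred (subst (j <_) (sym c+1≡n) j<n)) (λ j≡c → avoid (refl , sym j≡c))
  closure-down r c i j bd i+2≤m j<n avoid | false with suc r ≡ᵇ m in lastRow
  ... | true rewrite ≡ᵇ-false i r (λ i≡r → <-irrefl refl (subst₂ (λ a b → suc (suc a) ≤ b) i≡r (sym (≡ᵇ-true _ _ lastRow)) i+2≤m))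
                   | ≡ᵇ-sym (suc i) r = refl
  ... | false with bd
  ...   | inj₁ refl = refl
  ...   | inj₂ (inj₁ r+1≡m) rewrite r+1≡m | ≡ᵇ-refl m with () ← lastRow
  ...   | inj₂ (inj₂ (inj₁ refl)) = sym (∧-zeroʳ _)
  ...   | inj₂ (inj₂ (inj₂ c+1≡n)) rewrite c+1≡n | ≡ᵇ-refl n with () ← lastCol

  -- A vertical grid edge towards a node off Q does not change the winding parity: the
  -- edges of Q crossing the separating segment telescope to the contributions of its ends,
  -- which the closures cancel.
  winding-vertical : (∀ l → l < L → Adjℕ (R l) (C l) (R (suc l)) (C (suc l))) →
                     Boundaryℕ m n (R 0) (C 0) → Boundaryℕ m n (R L) (C L) →
                     ∀ i j → suc (suc i) ≤ m → j < n → Avoids (suc i) j → winding i j ≡ winding (suc i) j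
  winding-vertical walk bd₀ bd₁ i j i+2≤m j<n avoid = xor≡false⇒≡ (winding i j) (winding (suc i) j) total
    where
    sep : ℕ → Bool
    sep l = onSeparator i j (R l) (C l)
    rays : rayParity i j xor rayParity (suc i) j ≡ sep 0 xor sep L
    rays = trans (sym (parity-xor (crossing i j) (crossing (suc i) j) L))
             (trans (parity-cong (λ l → crossing i j l xor crossing (suc i) j l) (λ l → sep l xor sep (suc l)) L
                      (λ l l<L → crosses-down i j (R l) (C l) (R (suc l)) (C (suc l)) (walk l l<L)
                                   (avoid l (<⇒≤ l<L)) (avoid (suc l) l<L)))
                    (parity-telescope sep L))
    g₀ g₁ : ℕ → Bool
    g₀ i' = closure (R 0) (C 0) i' j
    g₁ i' = closure (R L) (C L) i' j
    closures : (g₀ i xor g₁ i) xor (g₀ (suc i) xor g₁ (suc i)) ≡ sep 0 xor sep L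
    closures = trans (xor-interchange (g₀ i) (g₁ i) (g₀ (suc i)) (g₁ (suc i)))
                     (cong₂ _xor_ (closure-down (R 0) (C 0) i j bd₀ i+2≤m j<n (avoid 0 z≤n))
                                  (closure-down (R L) (C L) i j bd₁ i+2≤m j<n (avoid L ≤-refl)))
    total : winding i j xor winding (suc i) j ≡ false
    total = trans (xor-interchange (rayParity i j) (g₀ i xor g₁ i) (rayParity (suc i) j) (g₀ (suc i) xor g₁ (suc i)))
              (trans (cong₂ _xor_ rays closures) (xor-same (sep 0 xor sep L)))

  -- Let Q be injective, avoid (0, j+2) and start with the edge (0, j+1)–(1, j+1).  This is
  -- then the only edge of Q in column j+1 between the top two rows, so the faces (0, j)
  -- and (0, j+2) on either side of it have different winding parities.
  winding-flip : (∀ l l' → l ≤ L → l' ≤ L → R l ≡ R l' → C l ≡ C l' → l ≡ l') →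
                 ∀ j → R 0 ≡ 0 → C 0 ≡ suc j → R 1 ≡ 1 → C 1 ≡ suc j → 1 ≤ L → ¬ m ≡ 1 →
                 Avoids 0 (suc (suc j)) → winding 0 j ≡ not (winding 0 (suc (suc j)))
  winding-flip injective j r₀ c₀ r₁ c₁ 1≤L m≢1 avoid =
    trans (winding-shift 0 j)
      (trans (cong₂ _xor_ (winding-horizontal 0 (suc j) avoid)
               (cong₂ _xor_ firstEdgeOnly (cong₂ _xor_ (closureAt-top (R 0) (C 0) j m≢1) (closureAt-top (R L) (C L) j m≢1))))
             (xor-comm (winding 0 (suc (suc j))) true))
    where
    first : crossingAt 0 (suc j) 0 ≡ true
    first rewrite r₀ | c₀ | r₁ | c₁ | ≡ᵇ-refl j = refl
    later : ∀ l → 1 ≤ l → l < L → crossingAt 0 (suc j) l ≡ false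
    later l 1≤l l<L = ¬-not λ crossed → case crossingAt-end 0 (suc j) l crossed of λ where
      (inj₁ (r≡0 , c≡)) → <-irrefl (sym (injective l 0 (<⇒≤ l<L) z≤n (trans r≡0 (sym r₀)) (trans c≡ (sym c₀)))) 1≤l
      (inj₂ (r≡0 , c≡)) → 0≢1+n (sym (injective (suc l) 0 l<L z≤n (trans r≡0 (sym r₀)) (trans c≡ (sym c₀))))
    firstEdgeOnly : columnParity 0 (suc j) ≡ true
    firstEdgeOnly = parity-only-first (crossingAt 0 (suc j)) L 1≤L first later

-- Nodes of a path by natural-number index: 'at p l' is p l, clamped to the last node.
clamp : (k l : ℕ) → Fin (suc k)
clamp zero _ = Fin.zero
clamp (suc k) zero = Fin.zero
clamp (suc k) (suc l) = Fin.suc (clamp k l)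

toℕ-clamp : ∀ k l → l ≤ k → toℕ (clamp k l) ≡ l
toℕ-clamp zero zero _ = refl
toℕ-clamp (suc k) zero _ = refl
toℕ-clamp (suc k) (suc l) (s≤s l≤k) = cong suc (toℕ-clamp k l l≤k)

clamp-toℕ : ∀ k (a : Fin (suc k)) → clamp k (toℕ a) ≡ a
clamp-toℕ zero Fin.zero = refl
clamp-toℕ (suc k) Fin.zero = refl
clamp-toℕ (suc k) (Fin.suc a) = cong Fin.suc (clamp-toℕ k a)

at : ∀ {m n k} → Seq m n k → ℕ → Node m n
at {k = k} p l = p (clamp k l)

at-toℕ : ∀ {m n k} (p : Seq m n k) (a : Fin (suc k)) → at p (toℕ a) ≡ p a
at-toℕ {k = k} p a = cong p (clamp-toℕ k a)

row col : ∀ {m n} → Node m n → ℕ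
row u = toℕ (proj₁ u)
col u = toℕ (proj₂ u)

node-≡ : ∀ {m n} {u w : Node m n} → row u ≡ row w → col u ≡ col w → u ≡ w
node-≡ e₁ e₂ = cong₂ _,_ (toℕ-injective e₁) (toℕ-injective e₂)

node-≟ : ∀ {m n} (u w : Node m n) → Dec (u ≡ w)
node-≟ (a , b) (c , d) with a Fin.≟ c | b Fin.≟ d
... | yes refl | yes refl = yes refl
... | no a≢c | _ = no (λ e → a≢c (cong proj₁ e))
... | yes _ | no b≢d = no (λ e → b≢d (cong proj₂ e))

onPath? : ∀ {m n k} (p : Seq m n k) u → Dec (OnPath p u)
onPath? p u = any? (λ a → node-≟ (p a) u)

Adj⇒Adjℕ : ∀ {m n} {u w : Node m n} → Adj u w → Adjℕ (row u) (col u) (row w) (col w)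
Adj⇒Adjℕ (inj₁ (e , c)) = inj₁ (cong toℕ e , c)
Adj⇒Adjℕ (inj₂ (e , c)) = inj₂ (cong toℕ e , c)

Adjℕ⇒Adj : ∀ {m n} {u w : Node m n} → Adjℕ (row u) (col u) (row w) (col w) → Adj u w
Adjℕ⇒Adj (inj₁ (e , c)) = inj₁ (toℕ-injective e , c)
Adjℕ⇒Adj (inj₂ (e , c)) = inj₂ (toℕ-injective e , c)

walk-start : ∀ {m n} {A : Node m n → Set} {u v} → Walk A u v → A u
walk-start (stop a) = a
walk-start (step a _ _) = a

record Excursion {m n k} (p : Seq m n k) (b L : ℕ) : Set where
  field
    inRange : L + b ≤ k
    nonempty : 1 ≤ L
    startOnBoundary : Boundary (at p b)
    leaves : ¬ Boundary (at p (suc b))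
    returns : Boundary (at p (L + b))

module TopRowExcursion {m n k : ℕ} (p : Seq m n k) (isPath : IsPath p) (induced : IsInduced p)
  (nonSep : NonSeparating p) (b L : ℕ) (ex : Excursion p b L) (r₀ : row (at p b) ≡ 0) where

  open Excursion ex

  P : ℕ → Node m n
  P = at p

  R C : ℕ → ℕ
  R l = row (P (l + b))
  C l = col (P (l + b))

  open Winding m n L R C

  index : ∀ l → l ≤ L → toℕ (clamp k (l + b)) ≡ l + b
  index l l≤L = toℕ-clamp k (l + b) (≤-trans (+-monoˡ-≤ b l≤L) inRange)

  steps : ∀ l → l < L → Adjℕ (R l) (C l) (R (suc l)) (C (suc l))
  steps l l<L = Adj⇒Adjℕ (proj₂ isPath (clamp k (l + b)) (clamp k (suc l + b))
                  (inj₁ (trans (index (suc l) l<L) (cong suc (sym (index l (<⇒≤ l<L)))))))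

  injective : ∀ l l' → l ≤ L → l' ≤ L → R l ≡ R l' → C l ≡ C l' → l ≡ l'
  injective l l' l≤L l'≤L e₁ e₂ = +-cancelʳ-≡ b l l'
    (trans (sym (index l l≤L)) (trans (cong toℕ (proj₁ isPath (node-≡ e₁ e₂))) (index l' l'≤L)))

  avoids : ∀ w → ¬ OnPath p w → Avoids (row w) (col w)
  avoids w w∉p l l≤L (e₁ , e₂) = w∉p (clamp k (l + b) , node-≡ e₁ e₂)

  windingAt : Node m n → Bool
  windingAt z = winding (row z) (col z)

  adjacent-winding : ∀ {u w} → Avoids (row u) (col u) → Avoids (row w) (col w) → Adj u w →
                     windingAt u ≡ windingAt w
  adjacent-winding {i , j} {i' , j'} _ w∉Q (inj₁ (refl , inj₁ e)) =
    subst (λ z → winding (toℕ i) (toℕ j) ≡ winding (toℕ i) z) (sym e)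
      (winding-horizontal (toℕ i) (toℕ j) (subst (Avoids (toℕ i)) e w∉Q))
  adjacent-winding {i , j} {i' , j'} u∉Q _ (inj₁ (refl , inj₂ e)) =
    sym (subst (λ z → winding (toℕ i) (toℕ j') ≡ winding (toℕ i) z) (sym e)
      (winding-horizontal (toℕ i) (toℕ j') (subst (Avoids (toℕ i)) e u∉Q)))
  adjacent-winding {i , j} {i' , j'} _ w∉Q (inj₂ (refl , inj₁ e)) =
    subst (λ z → winding (toℕ i) (toℕ j) ≡ winding z (toℕ j)) (sym e)
      (winding-vertical steps (inj₁ r₀) returns (toℕ i) (toℕ j) (subst (_< m) e (toℕ<n i')) (toℕ<n j)
        (subst (λ z → Avoids z (toℕ j)) e w∉Q))
  adjacent-winding {i , j} {i' , j'} u∉Q _ (inj₂ (refl , inj₂ e)) =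
    sym (subst (λ z → winding (toℕ i') (toℕ j) ≡ winding z (toℕ j)) (sym e)
      (winding-vertical steps (inj₁ r₀) returns (toℕ i') (toℕ j) (subst (_< m) e (toℕ<n i)) (toℕ<n j)
        (subst (λ z → Avoids z (toℕ j)) e u∉Q)))

  walk-winding : ∀ {u v} → Walk (λ x → ¬ OnPath p x) u v → windingAt u ≡ windingAt v
  walk-winding (stop _) = refl
  walk-winding {u} (step u∉p u~w walk) =
    trans (adjacent-winding (avoids u u∉p) (avoids _ (walk-start walk)) u~w) (walk-winding walk)

  -- As P is induced, a neighbour of P b other than P (b+1) is off P or equals P (b-1);
  -- either way it is off Q.
  neighbour-avoids : ∀ w → Adj w (P b) → ¬ w ≡ P (suc b) → Avoids (row w) (col w)
  neighbour-avoids w w~start w≢second l l≤L (e₁ , e₂)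
    with induced (clamp k (l + b)) (clamp k b) (subst (λ z → Adj z (P b)) (sym (node-≡ e₁ e₂)) w~start)
  ... | inj₁ e = m≢1+n+m b (trans (sym (index 0 z≤n)) (trans e (cong suc (index l l≤L))))
  ... | inj₂ e = w≢second (trans (sym (node-≡ e₁ e₂))
                   (cong P (trans (sym (index l l≤L)) (trans e (cong suc (index 0 z≤n))))))

  -- A unit square w, P b, P (b+1), w' with w, w' both on the induced path P is impossible:
  -- w would be P (b-1) and w' would be P (b+2), yet they are adjacent.
  square-not-on-path : ∀ (w w' : Node m n) → Adj w (P b) → Adj w' (P (suc b)) → Adj w' w →
                       ¬ w ≡ P (suc b) → ¬ w' ≡ P b → OnPath p w → OnPath p w' → ⊥
  square-not-on-path w w' w~start w'~second w'~w w≢second w'≢start (a , pa≡w) (a' , pa'≡w')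
    with induced a (clamp k b) (subst (λ z → Adj z (P b)) (sym pa≡w) w~start)
  ... | inj₂ e = w≢second (trans (sym pa≡w)
                   (cong p (trans (sym (clamp-toℕ k a)) (cong (clamp k) (trans e (cong suc (index 0 z≤n)))))))
  ... | inj₁ e with induced a' (clamp k (suc b)) (subst (λ z → Adj z (P (suc b))) (sym pa'≡w') w'~second)
  ...   | inj₁ e' = w'≢start (trans (sym pa'≡w')
                      (cong p (trans (sym (clamp-toℕ k a'))
                        (cong (clamp k) (suc-injective (trans (sym e') (index 1 nonempty)))))))
  ...   | inj₂ e' with induced a' a (subst₂ Adj (sym pa'≡w') (sym pa≡w) w'~w)
  ...     | inj₁ e'' = m≢1+n+m b (trans (trans (sym (index 0 z≤n)) e)
                         (cong suc (trans e'' (cong suc (trans e' (cong suc (index 1 nonempty)))))))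
  ...     | inj₂ e'' = m≢1+n+m b (trans (trans (sym (index 0 z≤n)) e)
                         (trans (sym e'') (trans e' (cong suc (index 1 nonempty)))))

  -- Beside the first edge P b – P (b+1) (going down from the top row) lie the nodes
  -- w = (0, c') and w' = (1, c').  One of them is off P and has the winding parity of w.
  module Beside (c' : ℕ) (c'<n : c' < n) (1<m : 1 < m) (r₁ : R 1 ≡ 1) (c₁ : C 1 ≡ C 0)
                (side : C 0 ≡ suc c' ⊎ c' ≡ suc (C 0)) where

    0<m : 0 < m
    0<m = ≤-trans (s≤s z≤n) 1<m

    w w' : Node m n
    w = fromℕ< 0<m , fromℕ< c'<n
    w' = fromℕ< 1<m , fromℕ< c'<n

    row-w : row w ≡ 0
    row-w = toℕ-fromℕ< 0<m

    row-w' : row w' ≡ 1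
    row-w' = toℕ-fromℕ< 1<m

    col-w : col w ≡ c'
    col-w = toℕ-fromℕ< c'<n

    beside : ∀ {x y} → x ≡ c' → y ≡ C 0 → y ≡ suc x ⊎ x ≡ suc y
    beside x≡c' y≡C₀ = subst₂ (λ x y → y ≡ suc x ⊎ x ≡ suc y) (sym x≡c') (sym y≡C₀) side

    w~start : Adj w (P b)
    w~start = Adjℕ⇒Adj (inj₁ (trans row-w (sym r₀) , beside col-w refl))

    w'~second : Adj w' (P (suc b))
    w'~second = Adjℕ⇒Adj (inj₁ (trans row-w' (sym r₁) , beside col-w c₁))

    w'~w : Adj w' w
    w'~w = Adjℕ⇒Adj (inj₂ (refl , inj₂ (trans row-w' (cong suc (sym row-w)))))

    w≢second : ¬ w ≡ P (suc b)
    w≢second e with trans (sym row-w) (trans (cong row e) r₁)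
    ... | ()

    w'≢start : ¬ w' ≡ P b
    w'≢start e with trans (sym row-w') (trans (cong row e) r₀)
    ... | ()

    w-avoids : Avoids 0 c'
    w-avoids = subst₂ Avoids row-w col-w (neighbour-avoids w w~start w≢second)

    representative : Σ (Node m n) λ z → ¬ OnPath p z × windingAt z ≡ winding 0 c'
    representative with onPath? p w
    ... | no w∉p = w , w∉p , cong₂ winding row-w col-w
    ... | yes w∈p = w' , w'∉p , trans (adjacent-winding (avoids w' w'∉p) (neighbour-avoids w w~start w≢second) w'~w)
                                       (cong₂ winding row-w col-w)
      where
      w'∉p : ¬ OnPath p w'
      w'∉p w'∈p = square-not-on-path w w' w~start w'~second w'~w w≢second w'≢start w∈p w'∈p

  -- P (b+1) is interior, so the first step of the excursion goes straight down.
  firstStepDown : R 1 ≡ 1 × C 1 ≡ C 0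
  firstStepDown with steps 0 nonempty
  ... | inj₁ (e , _) = ⊥-elim (leaves (inj₁ (trans (sym e) r₀)))
  ... | inj₂ (e , inj₁ down) = trans down (cong suc r₀) , sym e
  ... | inj₂ (e , inj₂ up) with trans (sym r₀) up
  ...   | ()

  -- P (b+1) is interior, so it is not in column 0.
  interiorColumn : ∃ λ j → C 1 ≡ suc j
  interiorColumn with C 1 in e
  ... | zero = ⊥-elim (leaves (inj₂ (inj₂ (inj₁ e))))
  ... | suc j = j , refl

  -- The faces left and right of the first edge have different winding parities, but the
  -- representatives of the two sides are joined by a walk avoiding P.
  impossible : ⊥
  impossible with firstStepDown | interiorColumn
  ... | r₁ , c₁ | j , c₁≡ = not-¬ (walk-winding (nonSep u v u∉p v∉p)) differ
    where
    2<m : 2 < m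
    2<m = ≤∧≢⇒< (subst (_< m) r₁ (toℕ<n (proj₁ (P (suc b)))))
                 (λ e → leaves (inj₂ (inj₁ (trans (cong suc r₁) e))))
    j+2<n : suc (suc j) < n
    j+2<n = ≤∧≢⇒< (subst (_< n) c₁≡ (toℕ<n (proj₂ (P (suc b)))))
                  (λ e → leaves (inj₂ (inj₂ (inj₂ (trans (cong suc c₁≡) e)))))
    1<m : 1 < m
    1<m = ≤-trans (s≤s (s≤s z≤n)) 2<m
    c₀ : C 0 ≡ suc j
    c₀ = trans (sym c₁) c₁≡
    module Left = Beside j (≤-trans (n≤1+n _) (≤-trans (n≤1+n _) j+2<n)) 1<m r₁ c₁ (inj₁ c₀)
    module Right = Beside (suc (suc j)) j+2<n 1<m r₁ c₁ (inj₂ (cong suc (sym c₀)))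
    u v : Node m n
    u = proj₁ Left.representative
    v = proj₁ Right.representative
    u∉p : ¬ OnPath p u
    u∉p = proj₁ (proj₂ Left.representative)
    v∉p : ¬ OnPath p v
    v∉p = proj₁ (proj₂ Right.representative)
    differ : windingAt u ≡ not (windingAt v)
    differ = begin
        windingAt u
      ≡⟨ proj₂ (proj₂ Left.representative) ⟩
        winding 0 j
      ≡⟨ winding-flip injective j r₀ c₀ r₁ c₁≡ nonempty (λ e → <-irrefl (sym e) (≤-trans (s≤s (s≤s z≤n)) 2<m))
                      Right.w-avoids ⟩
        not (winding 0 (suc (suc j)))
      ≡⟨ cong not (sym (proj₂ (proj₂ Right.representative))) ⟩
        not (windingAt v)
      ∎
      where open ≡-Reasoning

record GridIso (m n m' n' : ℕ) : Set where
  field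
    to : Node m n → Node m' n'
    from : Node m' n' → Node m n
    from-to : ∀ x → from (to x) ≡ x
    to-from : ∀ y → to (from y) ≡ y
    to-adj : ∀ x y → Adj x y → Adj (to x) (to y)
    from-adj : ∀ x y → Adj x y → Adj (from x) (from y)
    to-boundary : ∀ x → Boundary x → Boundary (to x)
    from-boundary : ∀ x → Boundary x → Boundary (from x)

_∘-iso_ : ∀ {a b c d e f} → GridIso a b c d → GridIso c d e f → GridIso a b e f
I ∘-iso J = record
  { to = λ x → J.to (I.to x)
  ; from = λ y → I.from (J.from y)
  ; from-to = λ x → trans (cong I.from (J.from-to _)) (I.from-to x)
  ; to-from = λ y → trans (cong J.to (I.to-from _)) (J.to-from y)
  ; to-adj = λ x y a → J.to-adj _ _ (I.to-adj _ _ a)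
  ; from-adj = λ x y a → I.from-adj _ _ (J.from-adj _ _ a)
  ; to-boundary = λ x bd → J.to-boundary _ (I.to-boundary _ bd)
  ; from-boundary = λ x bd → I.from-boundary _ (J.from-boundary _ bd) }
  where
  module I = GridIso I
  module J = GridIso J

transpose : ∀ {m n} → Node m n → Node n m
transpose (i , j) = (j , i)

transpose-adj : ∀ {m n} (x y : Node m n) → Adj x y → Adj (transpose x) (transpose y)
transpose-adj _ _ (inj₁ x) = inj₂ x
transpose-adj _ _ (inj₂ x) = inj₁ x

transpose-boundary : ∀ {m n} (x : Node m n) → Boundary x → Boundary (transpose x)
transpose-boundary _ (inj₁ x) = inj₂ (inj₂ (inj₁ x))
transpose-boundary _ (inj₂ (inj₁ x)) = inj₂ (inj₂ (inj₂ x))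
transpose-boundary _ (inj₂ (inj₂ (inj₁ x))) = inj₁ x
transpose-boundary _ (inj₂ (inj₂ (inj₂ x))) = inj₂ (inj₁ x)

transpose-iso : ∀ m n → GridIso m n n m
transpose-iso m n = record
  { to = transpose ; from = transpose ; from-to = λ _ → refl ; to-from = λ _ → refl
  ; to-adj = transpose-adj ; from-adj = transpose-adj
  ; to-boundary = transpose-boundary ; from-boundary = transpose-boundary }

reflect : ∀ {m n} → Node m n → Node m n
reflect (i , j) = (opposite i , j)

opposite-consec : ∀ {m} (i i' : Fin m) → toℕ i' ≡ suc (toℕ i) → toℕ (opposite i) ≡ suc (toℕ (opposite i'))
opposite-consec {suc m} i i' i'≡i+1 = begin
    toℕ (opposite i)              ≡⟨ opposite-prop i ⟩
    m ∸ toℕ i                     ≡⟨ +-∸-assoc 1 i<m ⟩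
    suc (m ∸ suc (toℕ i))         ≡⟨ cong (λ z → suc (m ∸ z)) (sym i'≡i+1) ⟩
    suc (m ∸ toℕ i')              ≡⟨ cong suc (sym (opposite-prop i')) ⟩
    suc (toℕ (opposite i'))       ∎
  where
  open ≡-Reasoning
  i<m : suc (toℕ i) ≤ m
  i<m = subst (_≤ m) i'≡i+1 (≤-pred (toℕ<n i'))

opposite-last : ∀ {m} (i : Fin m) → suc (toℕ i) ≡ m → toℕ (opposite i) ≡ 0
opposite-last {suc m} i last = trans (opposite-prop i) (trans (cong (m ∸_) (suc-injective last)) (n∸n≡0 m))

reflect-adj : ∀ {m n} (x y : Node m n) → Adj x y → Adj (reflect x) (reflect y)
reflect-adj _ _ (inj₁ (e , c)) = inj₁ (cong opposite e , c)
reflect-adj (i , _) (i' , _) (inj₂ (e , inj₁ c)) = inj₂ (e , inj₂ (opposite-consec i i' c))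
reflect-adj (i , _) (i' , _) (inj₂ (e , inj₂ c)) = inj₂ (e , inj₁ (opposite-consec i' i c))

reflect-boundary : ∀ {m n} (x : Node m n) → Boundary x → Boundary (reflect x)
reflect-boundary {suc m} (i , _) (inj₁ first) =
  inj₂ (inj₁ (cong suc (trans (opposite-prop i) (cong (m ∸_) first))))
reflect-boundary (i , _) (inj₂ (inj₁ last)) = inj₁ (opposite-last i last)
reflect-boundary _ (inj₂ (inj₂ x)) = inj₂ (inj₂ x)

reflect-involutive : ∀ {m n} (x : Node m n) → reflect (reflect x) ≡ x
reflect-involutive (i , j) = cong (_, j) (opposite-involutive i)

reflect-iso : ∀ m n → GridIso m n m n
reflect-iso m n = record
  { to = reflect ; from = reflect ; from-to = reflect-involutive ; to-from = reflect-involutive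
  ; to-adj = reflect-adj ; from-adj = reflect-adj
  ; to-boundary = reflect-boundary ; from-boundary = reflect-boundary }

mapWalk : ∀ {m n m' n'} {A : Node m n → Set} {A' : Node m' n' → Set} (σ : Node m n → Node m' n') →
          (∀ x → A x → A' (σ x)) → (∀ x y → Adj x y → Adj (σ x) (σ y)) →
          ∀ {u v} → Walk A u v → Walk A' (σ u) (σ v)
mapWalk σ keep adj (stop a) = stop (keep _ a)
mapWalk σ keep adj (step a u~w walk) = step (keep _ a) (adj _ _ u~w) (mapWalk σ keep adj walk)

module Transport {m n m' n' k : ℕ} (iso : GridIso m n m' n') (p : Seq m n k) where
  open GridIso iso

  q : Seq m' n' k
  q a = to (p a)

  to-injective : ∀ {x y} → to x ≡ to y → x ≡ y
  to-injective {x} {y} e = trans (sym (from-to x)) (trans (cong from e) (from-to y))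

  to-adj⁻¹ : ∀ x y → Adj (to x) (to y) → Adj x y
  to-adj⁻¹ x y a = subst₂ Adj (from-to x) (from-to y) (from-adj _ _ a)

  to-boundary⁻¹ : ∀ x → Boundary (to x) → Boundary x
  to-boundary⁻¹ x bd = subst Boundary (from-to x) (from-boundary _ bd)

  isPath : IsPath p → IsPath q
  isPath (inj , adj) = (λ e → inj (to-injective e)) , (λ a b c → to-adj _ _ (adj a b c))

  induced : IsInduced p → IsInduced q
  induced ind a b a~b = ind a b (to-adj⁻¹ _ _ a~b)

  nonSeparating : NonSeparating p → NonSeparating q
  nonSeparating nonSep u v u∉q v∉q = subst₂ (Walk (λ x → ¬ OnPath q x)) (to-from u) (to-from v)
     (mapWalk to keep to-adj (nonSep (from u) (from v) (pull u∉q) (pull v∉q)))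
    where
    pull : ∀ {u} → ¬ OnPath q u → ¬ OnPath p (from u)
    pull {u} u∉q (a , e) = u∉q (a , trans (cong to e) (to-from u))
    keep : ∀ x → ¬ OnPath p x → ¬ OnPath q (to x)
    keep x x∉p (a , e) = x∉p (a , to-injective e)

  excursion : ∀ {b L} → Excursion p b L → Excursion q b L
  excursion ex = record
    { inRange = inRange ; nonempty = nonempty
    ; startOnBoundary = to-boundary _ startOnBoundary
    ; leaves = λ bd → leaves (to-boundary⁻¹ _ bd)
    ; returns = to-boundary _ returns }
    where open Excursion ex

excursionViaIso : ∀ {m n m' n' k} (iso : GridIso m n m' n') (p : Seq m n k) →
  IsPath p → IsInduced p → NonSeparating p → ∀ b L → Excursion p b L →
  row (GridIso.to iso (at p b)) ≡ 0 → ⊥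
excursionViaIso iso p isPath induced nonSep b L ex =
  TopRowExcursion.impossible (Transport.q iso p) (Transport.isPath iso p isPath) (Transport.induced iso p induced)
    (Transport.nonSeparating iso p nonSep) b L (Transport.excursion iso p ex)

-- Every excursion starts on some side of the grid; a symmetry moves that side to the top.
noExcursion : ∀ {m n k} (p : Seq m n k) → IsPath p → IsInduced p → NonSeparating p →
              ∀ b L → Excursion p b L → ⊥
noExcursion {m} {n} p isPath induced nonSep b L ex with Excursion.startOnBoundary ex
... | inj₁ firstRow =
  TopRowExcursion.impossible p isPath induced nonSep b L ex firstRow
... | inj₂ (inj₁ lastRow) =
  excursionViaIso (reflect-iso m n) p isPath induced nonSep b L ex (opposite-last _ lastRow)
... | inj₂ (inj₂ (inj₁ firstCol)) =
  excursionViaIso (transpose-iso m n) p isPath induced nonSep b L ex firstCol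
... | inj₂ (inj₂ (inj₂ lastCol)) =
  excursionViaIso (transpose-iso m n ∘-iso reflect-iso n m) p isPath induced nonSep b L ex (opposite-last _ lastCol)

-- If one boundary subpath ends at b before another one ends, then p leaves the boundary
-- right after b and returns to it at the start a' of the other: an excursion.
excursionBetween : ∀ {m n k} (p : Seq m n k) {a b a' b' : Fin (suc k)} →
  IsBoundarySubpath p a b → IsBoundarySubpath p a' b' → toℕ b < toℕ b' →
  Excursion p (toℕ b) (toℕ a' ∸ toℕ b)
excursionBetween {k = k} p {b = b} {a'} {b'} (a≤b , onBoundary , _ , maxEnd) (a'≤b' , onBoundary' , _ , _) b<b'
  with maxEnd
... | inj₁ b≡k = ⊥-elim (<-irrefl refl (≤-trans (s≤s (subst (_< toℕ b') b≡k b<b')) (toℕ<n b')))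
... | inj₂ (l , l≡b+1 , l∉∂) with toℕ a' ≤? toℕ l
...   | yes a'≤l = ⊥-elim (l∉∂ (onBoundary' l a'≤l (subst (_≤ toℕ b') (sym l≡b+1) b<b')))
...   | no a'≰l = record
  { inRange = subst (_≤ k) (sym back) (≤-pred (toℕ<n a'))
  ; nonempty = m<n⇒0<n∸m (≤-trans (n≤1+n _) b+2≤a')
  ; startOnBoundary = subst Boundary (sym (at-toℕ p b)) (onBoundary b a≤b ≤-refl)
  ; leaves = λ bd → l∉∂ (subst Boundary (trans (cong (at p) (sym l≡b+1)) (at-toℕ p l)) bd)
  ; returns = subst Boundary (sym (trans (cong (at p) back) (at-toℕ p a'))) (onBoundary' a' ≤-refl a'≤b') }
  where
  b+2≤a' : suc (suc (toℕ b)) ≤ toℕ a'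
  b+2≤a' = subst (λ z → suc z ≤ toℕ a') l≡b+1 (≰⇒> a'≰l)
  back : (toℕ a' ∸ toℕ b) + toℕ b ≡ toℕ a'
  back = m∸n+n≡m (≤-trans (n≤1+n _) (≤-trans (n≤1+n _) b+2≤a'))

-- By maximality, boundary subpaths ending at the same node start at the same node.
sameEnd⇒¬startBefore : ∀ {m n k} (p : Seq m n k) {a b a' b' : Fin (suc k)} →
  IsBoundarySubpath p a b → IsBoundarySubpath p a' b' → toℕ b ≡ toℕ b' → ¬ toℕ a < toℕ a'
sameEnd⇒¬startBefore p (_ , onBoundary , _ , _) (a'≤b' , _ , maxStart' , _) b≡b' a<a' with maxStart'
... | inj₁ a'≡0 = n≮0 (subst (_ <_) a'≡0 a<a')
... | inj₂ (l , l+1≡a' , l∉∂) =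
  l∉∂ (onBoundary l (≤-pred (subst (_ <_) (sym l+1≡a') a<a'))
                    (≤-trans (n≤1+n _) (subst (_≤ _) (sym l+1≡a') (subst (_ ≤_) (sym b≡b') a'≤b'))))

lemma2 : ∀ (m n : ℕ) (s t : Node m n) (k : ℕ) (p : Seq m n k) →
    IsSTPath s t p → IsInduced p → NonSeparating p →
    ∀ (a b a' b' : Fin (suc k)) →
    IsBoundarySubpath p a b → IsBoundarySubpath p a' b' →
    a ≡ a' × b ≡ b'
lemma2 m n s t k p (isPath , _) induced nonSep a b a' b' sub sub' = toℕ-injective starts , toℕ-injective ends
  where
  notBefore : ∀ {a b a' b'} → IsBoundarySubpath p a b → IsBoundarySubpath p a' b' → ¬ toℕ b < toℕ b'
  notBefore sub sub' b<b' = noExcursion p isPath induced nonSep _ _ (excursionBetween p sub sub' b<b')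
  ends : toℕ b ≡ toℕ b'
  ends = ≤-antisym (≮⇒≥ (notBefore sub' sub)) (≮⇒≥ (notBefore sub sub'))
  starts : toℕ a ≡ toℕ a'
  starts = ≤-antisym (≮⇒≥ (sameEnd⇒¬startBefore p sub' sub (sym ends)))
                     (≮⇒≥ (sameEnd⇒¬startBefore p sub sub' ends))
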